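{- For all integers $m,n\geq 0$, the lattice $\mathbf{W}(m,n)$ is trim.
   Context: An $(m,n)$-word is a word $\mathfrak{w}=w_1w_2\cdots w_n$ of length $n$ over the alphabet $\{0,1,\dots,m+1\}$ such that (MN1) $w_1\neq m+1$, and (MN2) for every $s$ with $1\le s\le m$ and every index $i$, if $w_i=s$ then $w_j\ge s$ for all $j<i$. $\mathbf{W}(m,n)$ is the set of $(m,n)$-words ordered componentwise; this is a lattice. The length $\ell(\mathbf{P})$ of a finite lattice is one less than the maximum cardinality of a chain. A finite lattice $\mathbf{P}$ is extremal if its number of join-irreducible elements, $\ell(\mathbf{P})$, and its number of meet-irreducible elements coincide (join-irreducible: $j=p\vee q$ implies $p=j$ or $q=j$, bottom excluded; meet-irreducible dually). An element $x$ is left modular if $(p\vee x)\wedge q=p\vee(x\wedge q)$ for all $p<q$. $\mathbf{P}$ is trim if it is extremal and contains a chain of length $\ell(\mathbf{P})$ consisting entirely of left-modular elements. -}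

module Defs where

open import Data.Nat as ℕ using (ℕ; zero; suc; _+_)
open import Data.Fin as Fin using (Fin; toℕ)
open import Data.Vec using (Vec; lookup)
open import Data.List using (List; length)
open import Data.List.Membership.Propositional using (_∈_)
open import Data.List.Relation.Unary.All using (All)
open import Data.List.Relation.Unary.Linked using (Linked)
open import Data.List.Relation.Unary.Unique.Propositional using (Unique)
open import Data.Product using (Σ; ∃; _×_)
open import Data.Sum using (_⊎_)
open import Relation.Nullary using (¬_)
open import Relation.Binary.PropositionalEquality using (_≡_; _≢_)
open import Function.Bundles using (_⇔_)

module Poset {A : Set} (P : A → Set) (_≤_ : A → A → Set) where

  _<_ : A → A → Set
  x < y = x ≤ y × x ≢ y

  IsJoin : A → A → A → Set
  IsJoin x y z = P z × x ≤ z × y ≤ z × (∀ u → P u → x ≤ u → y ≤ u → z ≤ u)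

  IsMeet : A → A → A → Set
  IsMeet x y z = P z × z ≤ x × z ≤ y × (∀ u → P u → u ≤ x → u ≤ y → u ≤ z)

  IsLattice : Set
  IsLattice = ∀ x y → P x → P y → (∃ λ z → IsJoin x y z) × (∃ λ z → IsMeet x y z)

  IsBottom : A → Set
  IsBottom x = ∀ u → P u → x ≤ u

  IsTop : A → Set
  IsTop x = ∀ u → P u → u ≤ x

  JoinIrr : A → Set
  JoinIrr j = P j × ¬ IsBottom j ×
    (∀ p q → P p → P q → IsJoin p q j → p ≡ j ⊎ q ≡ j)

  MeetIrr : A → Set
  MeetIrr j = P j × ¬ IsTop j ×
    (∀ p q → P p → P q → IsMeet p q j → p ≡ j ⊎ q ≡ j)

  HasSize : (A → Set) → ℕ → Set
  HasSize Q k = Σ (List A) λ l → Unique l × length l ≡ k × (∀ x → (x ∈ l) ⇔ Q x)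

  IsChain : List A → Set
  IsChain c = All P c × Linked _<_ c

  -- the length ℓ of the poset: maximal chain cardinality minus one
  HasLength : ℕ → Set
  HasLength L = (Σ (List A) λ c → IsChain c × length c ≡ suc L)
              × (∀ c → IsChain c → length c ℕ.≤ suc L)

  -- x is left modular: (p ∨ x) ∧ q = p ∨ (x ∧ q) for all p < q
  LeftModular : A → Set
  LeftModular x = P x × (∀ p q → P p → P q → p < q →
    ∀ a b c d → IsJoin p x a → IsMeet a q b → IsMeet x q c → IsJoin p c d → b ≡ d)

  ExtremalWith : ℕ → Set
  ExtremalWith L = HasLength L × HasSize JoinIrr L × HasSize MeetIrr L

  Extremal : Set
  Extremal = ∃ λ L → ExtremalWith L

  Trim : Set
  Trim = IsLattice × (∃ λ L → ExtremalWith L ×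
    (Σ (List A) λ c → IsChain c × length c ≡ suc L × All LeftModular c))

Letter : ℕ → Set
Letter m = Fin (suc (suc m))

record IsWord (m n : ℕ) (w : Vec (Letter m) n) : Set where
  field
    mn1 : ∀ (i : Fin n) → toℕ i ≡ 0 → toℕ (lookup w i) ≢ suc m
    mn2 : ∀ (s : ℕ) → 1 ℕ.≤ s → s ℕ.≤ m → ∀ (i j : Fin n) →
          toℕ (lookup w i) ≡ s → j Fin.< i → s ℕ.≤ toℕ (lookup w j)

_≤W_ : ∀ {m n} → Vec (Letter m) n → Vec (Letter m) n → Set
u ≤W v = ∀ i → lookup u i Fin.≤ lookup v i

module W (m n : ℕ) = Poset (IsWord m n) (_≤W_ {m} {n})

-- Joins in W(m, n) are letterwise maxima; meets are letterwise minima, lowered to prefix minima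
-- wherever MN2 requires it. Hence a join-irreducible word is determined by its last nonzero letter:
-- it is the least word carrying a given letter v ≥ 1 at a given position. Dually, a meet-irreducible
-- word differs from the top word m (m+1) ⋯ (m+1) in exactly one letter. Both families are indexed
-- by all pairs (position, letter) but one, so each has n(m+1) − 1 members. The sum of the letters is
-- a strictly monotone rank bounded by the same number, and it is attained by the chain of words
-- obtained by pouring r = 0, 1, 2, … units into the positions greedily from the left. Each such
-- staircase word is left modular.

module Submission where

open import Defs
open import Data.Nat as ℕ using (ℕ; zero; suc; _+_; _*_; _∸_; _⊔_; _⊓_; z≤n; s≤s; z<s)
open import Data.Nat.Properties
open import Algebra.Properties.Monoid.Sum +-0-monoid using (sum; sum-cong-≗)
open import Data.Fin as Fin using (Fin; toℕ; fromℕ<)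
import Data.Fin.Properties as Finₚ
open import Data.Vec using (Vec; []; lookup; tabulate)
open import Data.Vec.Properties using (lookup∘tabulate; tabulate∘lookup; tabulate-cong)
open import Data.Vec.Functional using (updateAt)
open import Data.Vec.Functional.Properties using (updateAt-updates; updateAt-minimal)
open import Data.List using (List; []; _∷_; _++_; length; drop; map; allFin; applyUpTo; cartesianProductWith)
open import Data.List.Properties using (length-++; length-map; length-tabulate; length-applyUpTo)
open import Data.List.Membership.Propositional using (_∈_)
open import Data.List.Membership.Propositional.Properties
  using (∈-allFin; ∈-cartesianProductWith⁺; ∈-cartesianProductWith⁻)
open import Data.List.Relation.Unary.All as All using (All; []; _∷_)
import Data.List.Relation.Unary.All.Properties as Allₚ
open import Data.List.Relation.Unary.Any using (here; there)
open import Data.List.Relation.Unary.AllPairs using ([]; _∷_)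
open import Data.List.Relation.Unary.Linked using (Linked; []; [-]; _∷_)
import Data.List.Relation.Unary.Linked.Properties as Linkedₚ
open import Data.List.Relation.Unary.Unique.Propositional using (Unique)
import Data.List.Relation.Unary.Unique.Propositional.Properties as Uniqueₚ
open import Data.Product using (Σ; ∃; ∃₂; _×_; _,_; proj₁; proj₂)
open import Data.Sum using (_⊎_; inj₁; inj₂)
open import Data.Empty using (⊥-elim)
open import Function using (_∘_; id; _⇔_; mk⇔)
open import Relation.Nullary using (¬_; ¬?; yes; no)
open import Relation.Nullary.Decidable using (decidable-stable)
open import Relation.Binary using (tri<; tri≈; tri>)
open import Relation.Unary using (Decidable)
open import Relation.Binary.PropositionalEquality

sum-const : ∀ K c → sum {K} (λ _ → c) ≡ K * c
sum-const zero    c = refl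
sum-const (suc K) c = cong (c +_) (sum-const K c)

sum-mono-≤ : ∀ {K} {f g : Fin K → ℕ} → (∀ k → f k ℕ.≤ g k) → sum f ℕ.≤ sum g
sum-mono-≤ {zero}  f≤g = z≤n
sum-mono-≤ {suc K} f≤g = +-mono-≤ (f≤g Fin.zero) (sum-mono-≤ (f≤g ∘ Fin.suc))

sum-mono-< : ∀ {K} {f g : Fin K → ℕ} → (∀ k → f k ℕ.≤ g k) →
             ∀ k → f k ℕ.< g k → sum f ℕ.< sum g
sum-mono-< f≤g Fin.zero    fk<gk = +-mono-<-≤ fk<gk (sum-mono-≤ (f≤g ∘ Fin.suc))
sum-mono-< f≤g (Fin.suc k) fk<gk = +-mono-≤-< (f≤g Fin.zero) (sum-mono-< (f≤g ∘ Fin.suc) k fk<gk)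

m≤n⊔o∧m≰n⇒m≤o : ∀ {m n o} → m ℕ.≤ n ⊔ o → ¬ m ℕ.≤ n → m ℕ.≤ o
m≤n⊔o∧m≰n⇒m≤o {m} {n} {o} m≤n⊔o m≰n with ⊔-sel n o
... | inj₁ n⊔o≡n = ⊥-elim (m≰n (subst (m ℕ.≤_) n⊔o≡n m≤n⊔o))
... | inj₂ n⊔o≡o = subst (m ℕ.≤_) n⊔o≡o m≤n⊔o

pour : ∀ {K} → (Fin K → ℕ) → ℕ → Fin K → ℕ
pour cap r Fin.zero    = cap Fin.zero ⊓ r
pour cap r (Fin.suc k) = pour (cap ∘ Fin.suc) (r ∸ cap Fin.zero) k

pour-≤-cap : ∀ {K} (cap : Fin K → ℕ) r k → pour cap r k ℕ.≤ cap k
pour-≤-cap cap r Fin.zero    = m⊓n≤m (cap Fin.zero) r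
pour-≤-cap cap r (Fin.suc k) = pour-≤-cap (cap ∘ Fin.suc) (r ∸ cap Fin.zero) k

pour-≤ : ∀ {K} (cap : Fin K → ℕ) r k → pour cap r k ℕ.≤ r
pour-≤ cap r Fin.zero    = m⊓n≤n (cap Fin.zero) r
pour-≤ cap r (Fin.suc k) = ≤-trans (pour-≤ (cap ∘ Fin.suc) (r ∸ cap Fin.zero) k) (m∸n≤m r (cap Fin.zero))

pour-monoʳ-≤ : ∀ {K} (cap : Fin K → ℕ) {r r′} → r ℕ.≤ r′ → ∀ k → pour cap r k ℕ.≤ pour cap r′ k
pour-monoʳ-≤ cap r≤r′ Fin.zero    = ⊓-monoʳ-≤ (cap Fin.zero) r≤r′
pour-monoʳ-≤ cap r≤r′ (Fin.suc k) = pour-monoʳ-≤ (cap ∘ Fin.suc) (∸-monoˡ-≤ (cap Fin.zero) r≤r′) k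

pour-full-before : ∀ {K} (cap : Fin K → ℕ) r {i j} → j Fin.< i → pour cap r i ≢ 0 → pour cap r j ≡ cap j
pour-full-before cap r {Fin.suc i} {Fin.zero} _ nonzero =
  m≤n⇒m⊓n≡m (<⇒≤ (m∸n≢0⇒n<m r∸cap₀≢0))
  where
  r∸cap₀≢0 : r ∸ cap Fin.zero ≢ 0
  r∸cap₀≢0 eq = nonzero (n≤0⇒n≡0 (subst (pour (cap ∘ Fin.suc) (r ∸ cap Fin.zero) i ℕ.≤_) eq
                                         (pour-≤ (cap ∘ Fin.suc) _ i)))
pour-full-before cap r {Fin.suc i} {Fin.suc j} (s≤s j<i) nonzero =
  pour-full-before (cap ∘ Fin.suc) (r ∸ cap Fin.zero) j<i nonzero

sum-pour : ∀ {K} (cap : Fin K → ℕ) {r} → r ℕ.≤ sum cap → sum (pour cap r) ≡ r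
sum-pour {zero}  cap r≤0 = sym (n≤0⇒n≡0 r≤0)
sum-pour {suc K} cap {r} r≤ = begin
  cap₀ ⊓ r + sum (pour (cap ∘ Fin.suc) (r ∸ cap₀))
    ≡⟨ cong (cap₀ ⊓ r +_) (sum-pour (cap ∘ Fin.suc) (m≤n+o⇒m∸n≤o r cap₀ r≤)) ⟩
  cap₀ ⊓ r + (r ∸ cap₀)
    ≡⟨ m⊓n+n∸m≡n cap₀ r ⟩
  r ∎
  where
  open ≡-Reasoning
  cap₀ = cap Fin.zero

∃⟶∃-greatest : ∀ {K} {P : Fin K → Set} → Decidable P → ∀ k → P k →
           ∃ λ i → P i × (∀ {j} → i Fin.< j → ¬ P j)
∃⟶∃-greatest {suc K} P? k Pk with Finₚ.any? (P? ∘ Fin.suc)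
... | yes (j , Pj) with ∃⟶∃-greatest (P? ∘ Fin.suc) j Pj
...   | i , Pi , none-after = Fin.suc i , Pi , λ { {Fin.suc j} (s≤s i<j) → none-after i<j }
∃⟶∃-greatest P? Fin.zero    Pk | no ¬any = Fin.zero , Pk , λ { {Fin.suc j} _ Pj → ¬any (j , Pj) }
∃⟶∃-greatest P? (Fin.suc k) Pk | no ¬any = ⊥-elim (¬any (k , Pk))

complement-injective : ∀ {c} {s s′ : Fin (suc c)} → c ∸ toℕ s ≡ c ∸ toℕ s′ → s ≡ s′
complement-injective eq = Finₚ.toℕ-injective (∸-cancelˡ-≡ (Finₚ.toℕ≤pred[n] _) (Finₚ.toℕ≤pred[n] _) eq)

complement-surjective : ∀ {c v} → v ℕ.≤ c → ∃ λ (s : Fin (suc c)) → c ∸ toℕ s ≡ v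
complement-surjective {c} {v} v≤c =
  fromℕ< c∸v<1+c , trans (cong (c ∸_) (Finₚ.toℕ-fromℕ< c∸v<1+c)) (m∸[m∸n]≡n v≤c)
  where
  c∸v<1+c = s≤s (m∸n≤m c v)

suc-complement-surjective : ∀ {c v} → 1 ℕ.≤ v → v ℕ.≤ suc c → ∃ λ (s : Fin (suc c)) → suc (c ∸ toℕ s) ≡ v
suc-complement-surjective {v = suc v} _ (s≤s v≤c) with complement-surjective v≤c
... | s , c∸s≡v = s , cong suc c∸s≡v

complement-suc-< : ∀ {c} (s : Fin c) → c ∸ toℕ (Fin.suc s) ℕ.< c
complement-suc-< s = ∸-monoʳ-< z<s (Finₚ.toℕ≤pred[n] (Fin.suc s))

module _ {A : Set} {_<_ : A → A → Set} (rank : A → ℕ)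
         (rank-< : ∀ {x y} → x < y → rank x ℕ.< rank y) where

  length-Linked-≤ : ∀ {L} xs → All (λ x → rank x ℕ.≤ L) xs → Linked _<_ xs → length xs ℕ.≤ suc L
  length-Linked-≤ []       _ _ = z≤n
  length-Linked-≤ {L} (x ∷ xs) ranks linked = ≤-trans (m≤m+n _ (rank x)) (length+rank≤ x xs ranks linked)
    where
    length+rank≤ : ∀ x xs → All (λ x → rank x ℕ.≤ L) (x ∷ xs) → Linked _<_ (x ∷ xs) →
                   length (x ∷ xs) + rank x ℕ.≤ suc L
    length+rank≤ x []       (rank≤L ∷ []) [-] = s≤s rank≤L
    length+rank≤ x (y ∷ ys) (_ ∷ ranks) (x<y ∷ linked) = begin
      suc (length (y ∷ ys) + rank x) ≡⟨ sym (+-suc (length (y ∷ ys)) (rank x)) ⟩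
      length (y ∷ ys) + suc (rank x) ≤⟨ +-monoʳ-≤ (length (y ∷ ys)) (rank-< x<y) ⟩
      length (y ∷ ys) + rank y       ≤⟨ length+rank≤ y ys ranks linked ⟩
      suc L                          ∎
      where open ≤-Reasoning

length-cartesianProductWith : ∀ {A B C : Set} (f : A → B → C) xs ys →
  length (cartesianProductWith f xs ys) ≡ length xs * length ys
length-cartesianProductWith f []       ys = refl
length-cartesianProductWith f (x ∷ xs) ys = begin
  length (map (f x) ys ++ cartesianProductWith f xs ys)
    ≡⟨ length-++ (map (f x) ys) ⟩
  length (map (f x) ys) + length (cartesianProductWith f xs ys)
    ≡⟨ cong₂ _+_ (length-map (f x) ys) (length-cartesianProductWith f xs ys) ⟩
  length ys + length xs * length ys
    ∎
  where open ≡-Reasoning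

NonOrigin : ∀ {a b} → Fin (suc a) → Fin (suc b) → Set
NonOrigin i s = ¬ (i ≡ Fin.zero × s ≡ Fin.zero)

module _ {C : Set} {a b : ℕ} (f : Fin (suc a) → Fin (suc b) → C)
         (f-injective : ∀ {i i′ s s′} → f i s ≡ f i′ s′ → i ≡ i′ × s ≡ s′) where

  private
    grid : List C
    grid = cartesianProductWith f (allFin (suc a)) (allFin (suc b))

    grid-unique : Unique grid
    grid-unique =
      Uniqueₚ.cartesianProductWith⁺ f f-injective (Uniqueₚ.allFin⁺ (suc a)) (Uniqueₚ.allFin⁺ (suc b))

  -- grid starts with f 0 0, which is dropped
  size-without-origin : (Q : C → Set) →
    (∀ i s → NonOrigin i s → Q (f i s)) →
    (∀ x → Q x → ∃₂ λ i s → NonOrigin i s × x ≡ f i s) →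
    Σ (List C) λ l → Unique l × length l ≡ b + a * suc b × (∀ x → (x ∈ l) ⇔ Q x)
  size-without-origin Q image⇒Q Q⇒image =
    drop 1 grid , Uniqueₚ.drop⁺ 1 grid-unique , length-rest , λ x → mk⇔ (∈⇒Q x) (Q⇒∈ x)
    where
    length-rest : length (drop 1 grid) ≡ b + a * suc b
    length-rest = cong ℕ.pred (begin
      length grid
        ≡⟨ length-cartesianProductWith f (allFin (suc a)) (allFin (suc b)) ⟩
      length (allFin (suc a)) * length (allFin (suc b))
        ≡⟨ cong₂ _*_ (length-tabulate {n = suc a} id) (length-tabulate {n = suc b} id) ⟩
      suc a * suc b
        ∎)
      where open ≡-Reasoning
    ∈⇒Q : ∀ x → x ∈ drop 1 grid → Q x
    ∈⇒Q x x∈ with grid-unique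
    ... | origin∉rest ∷ _ with ∈-cartesianProductWith⁻ f (allFin (suc a)) (allFin (suc b)) (there x∈)
    ...   | i , s , _ , _ , refl = image⇒Q i s λ { (refl , refl) → All.lookup origin∉rest x∈ refl }
    Q⇒∈ : ∀ x → Q x → x ∈ drop 1 grid
    Q⇒∈ x Qx with Q⇒image x Qx
    ... | i , s , nonOrigin , refl with ∈-cartesianProductWith⁺ f (∈-allFin i) (∈-allFin s)
    ...   | here eq = ⊥-elim (nonOrigin (f-injective eq))
    ...   | there x∈ = x∈

prefixMin : ∀ {K} → (Fin (suc K) → ℕ) → Fin (suc K) → ℕ
prefixMin z Fin.zero              = z Fin.zero
prefixMin {suc K} z (Fin.suc k) = z Fin.zero ⊓ prefixMin (z ∘ Fin.suc) k

prefixMin-≤ : ∀ {K} (z : Fin (suc K) → ℕ) {j k} → j Fin.≤ k → prefixMin z k ℕ.≤ z j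
prefixMin-≤ z {Fin.zero} {Fin.zero} _ = ≤-refl
prefixMin-≤ {suc K} z {Fin.zero} {Fin.suc k} _ = m⊓n≤m _ _
prefixMin-≤ {suc K} z {Fin.suc j} {Fin.suc k} (s≤s j≤k) =
  ≤-trans (m⊓n≤n _ _) (prefixMin-≤ (z ∘ Fin.suc) j≤k)

prefixMin-greatest : ∀ {K} (z : Fin (suc K) → ℕ) {c} k → (∀ j → j Fin.≤ k → c ℕ.≤ z j) → c ℕ.≤ prefixMin z k
prefixMin-greatest z Fin.zero c≤z = c≤z Fin.zero z≤n
prefixMin-greatest {suc K} z (Fin.suc k) c≤z =
  ⊓-glb (c≤z Fin.zero z≤n) (prefixMin-greatest (z ∘ Fin.suc) k (λ j j≤k → c≤z (Fin.suc j) (s≤s j≤k)))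

prefixMin-antitone : ∀ {K} (z : Fin (suc K) → ℕ) {j k} → j Fin.≤ k → prefixMin z k ℕ.≤ prefixMin z j
prefixMin-antitone z {j} j≤k = prefixMin-greatest z j (λ l l≤j → prefixMin-≤ z (≤-trans l≤j j≤k))

_!_ : ∀ {a k} → Vec (Fin a) k → Fin k → ℕ
w ! k = toℕ (lookup w k)

module WordLattice (m n : ℕ) where
  open W m (suc n)

  Pos : Set
  Pos = Fin (suc n)

  Word : Set
  Word = Vec (Letter m) (suc n)

  Bounded : (Pos → ℕ) → Set
  Bounded f = ∀ k → f k ℕ.≤ suc m

  MN2 : (Pos → ℕ) → Set
  MN2 f = ∀ {i j} → j Fin.< i → 1 ℕ.≤ f i → f i ℕ.≤ m → f i ℕ.≤ f j

  topLetter : Pos → ℕ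
  topLetter Fin.zero    = m
  topLetter (Fin.suc _) = suc m

  topLetter-bounded : Bounded topLetter
  topLetter-bounded Fin.zero    = n≤1+n m
  topLetter-bounded (Fin.suc _) = ≤-refl

  m≤topLetter : ∀ k → m ℕ.≤ topLetter k
  m≤topLetter Fin.zero    = ≤-refl
  m≤topLetter (Fin.suc _) = n≤1+n m

  L : ℕ
  L = m + n * suc m

  sum-topLetter : sum topLetter ≡ L
  sum-topLetter = cong (m +_) (sum-const n (suc m))

  letter≤ : (w : Word) → Bounded (w !_)
  letter≤ w k = Finₚ.toℕ≤pred[n] (lookup w k)

  letters-≡ : ∀ {u v : Word} → (∀ k → u ! k ≡ v ! k) → u ≡ v
  letters-≡ {u} {v} eq = begin
    u                   ≡⟨ sym (tabulate∘lookup u) ⟩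
    tabulate (lookup u) ≡⟨ tabulate-cong (Finₚ.toℕ-injective ∘ eq) ⟩
    tabulate (lookup v) ≡⟨ tabulate∘lookup v ⟩
    v                   ∎
    where open ≡-Reasoning

  ≤W-antisym : ∀ {u v : Word} → u ≤W v → v ≤W u → u ≡ v
  ≤W-antisym u≤v v≤u = letters-≡ λ k → ≤-antisym (u≤v k) (v≤u k)

  ≤W-trans : ∀ {u v w : Word} → u ≤W v → v ≤W w → u ≤W w
  ≤W-trans u≤v v≤w k = ≤-trans (u≤v k) (v≤w k)

  -- letters above m + 1 are clipped, so that every function is read as a word
  opaque
    clip : ℕ → Letter m
    clip v = fromℕ< (s≤s (m⊓n≤n v (suc m)))

    word : (Pos → ℕ) → Word
    word f = tabulate (clip ∘ f)

    word-! : ∀ f k → word f ! k ≡ f k ⊓ suc m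
    word-! f k = trans (cong toℕ (lookup∘tabulate (clip ∘ f) k)) (Finₚ.toℕ-fromℕ< _)

  bounded-word-! : ∀ {f} → Bounded f → ∀ k → word f ! k ≡ f k
  bounded-word-! {f} f≤ k = trans (word-! f k) (m≤n⇒m⊓n≡m (f≤ k))

  word-≤ : ∀ {f} (w : Word) → (∀ k → f k ℕ.≤ w ! k) → word f ≤W w
  word-≤ {f} _ f≤w k = subst (ℕ._≤ _) (sym (word-! f k)) (≤-trans (m⊓n≤m _ _) (f≤w k))

  ≤-word : ∀ {f} (w : Word) → (∀ k → w ! k ℕ.≤ f k) → w ≤W word f
  ≤-word {f} w w≤f k = subst (w ! k ℕ.≤_) (sym (word-! f k)) (⊓-glb (w≤f k) (letter≤ w k))

  isWord : ∀ {w : Word} → w ! Fin.zero ℕ.≤ m → MN2 (w !_) → IsWord m (suc n) w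
  isWord {w} w₀≤m w-mn2 = record { mn1 = mn1 ; mn2 = mn2′ }
    where
    mn1 : ∀ i → toℕ i ≡ 0 → w ! i ≢ suc m
    mn1 Fin.zero _ w₀≡1+m = 1+n≰n (subst (ℕ._≤ m) w₀≡1+m w₀≤m)
    mn2′ : ∀ s → 1 ℕ.≤ s → s ℕ.≤ m → ∀ i j → w ! i ≡ s → j Fin.< i → s ℕ.≤ w ! j
    mn2′ _ 1≤s s≤m i j refl j<i = w-mn2 j<i 1≤s s≤m

  word-isWord : ∀ {f} → Bounded f → f Fin.zero ℕ.≤ m → MN2 f → IsWord m (suc n) (word f)
  word-isWord {f} f≤ f₀≤m f-mn2 = isWord (subst (ℕ._≤ m) (sym (letters Fin.zero)) f₀≤m) mn2-word
    where
    letters = bounded-word-! f≤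
    mn2-word : MN2 (word f !_)
    mn2-word {i} {j} j<i rewrite letters i | letters j = f-mn2 j<i

  head≤m : ∀ {w} → IsWord m (suc n) w → w ! Fin.zero ℕ.≤ m
  head≤m {w} w-word with m≤n⇒m<n∨m≡n (letter≤ w Fin.zero)
  ... | inj₁ w₀<1+m = ≤-pred w₀<1+m
  ... | inj₂ w₀≡1+m = ⊥-elim (IsWord.mn1 w-word Fin.zero refl w₀≡1+m)

  mn2 : ∀ {w} → IsWord m (suc n) w → MN2 (w !_)
  mn2 {w} w-word {i} {j} j<i 1≤wᵢ wᵢ≤m = IsWord.mn2 w-word (w ! i) 1≤wᵢ wᵢ≤m i j refl j<i

  ≤topLetter : ∀ {w} → IsWord m (suc n) w → ∀ k → w ! k ℕ.≤ topLetter k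
  ≤topLetter w-word Fin.zero        = head≤m w-word
  ≤topLetter {w} _  (Fin.suc k) = letter≤ w (Fin.suc k)

  _∨_ : Word → Word → Word
  x ∨ y = word λ k → x ! k ⊔ y ! k

  ∨-bounded : ∀ x y → Bounded (λ k → x ! k ⊔ y ! k)
  ∨-bounded x y k = ⊔-lub (letter≤ x k) (letter≤ y k)

  ∨-isWord : ∀ {x y} → IsWord m (suc n) x → IsWord m (suc n) y → IsWord m (suc n) (x ∨ y)
  ∨-isWord {x} {y} x-word y-word = word-isWord (∨-bounded x y) (⊔-lub (head≤m x-word) (head≤m y-word)) mn2-⊔
    where
    mn2-⊔ : MN2 (λ k → x ! k ⊔ y ! k)
    mn2-⊔ {i} {j} j<i with ⊔-sel (x ! i) (y ! i)
    ... | inj₁ eq rewrite eq = λ 1≤xᵢ xᵢ≤m → ≤-trans (mn2 x-word j<i 1≤xᵢ xᵢ≤m) (m≤m⊔n _ _)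
    ... | inj₂ eq rewrite eq = λ 1≤yᵢ yᵢ≤m → ≤-trans (mn2 y-word j<i 1≤yᵢ yᵢ≤m) (m≤n⊔m _ _)

  ∨-isJoin : ∀ {x y : Word} → IsWord m (suc n) x → IsWord m (suc n) y → IsJoin x y (x ∨ y)
  ∨-isJoin {x} {y} x-word y-word =
    ∨-isWord x-word y-word , ≤-word x (λ _ → m≤m⊔n _ _) , ≤-word y (λ _ → m≤n⊔m _ _) ,
    λ u _ x≤u y≤u → word-≤ u (λ k → ⊔-lub (x≤u k) (y≤u k))

  join-! : ∀ {x y z} → IsWord m (suc n) x → IsWord m (suc n) y → IsJoin x y z →
           ∀ k → z ! k ≡ x ! k ⊔ y ! k
  join-! {x} {y} {z} x-word y-word (_ , x≤z , y≤z , z-least) k with ∨-isJoin x-word y-word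
  ... | x∨y-word , x≤x∨y , y≤x∨y , _ =
    ≤-antisym (subst (z ! k ℕ.≤_) (bounded-word-! (∨-bounded x y) k) (z-least (x ∨ y) x∨y-word x≤x∨y y≤x∨y k))
              (⊔-lub (x≤z k) (y≤z k))

  -- A letter m + 1 constrains nothing; any other letter may not exceed an earlier one.
  meetLetters : Word → Word → Pos → ℕ
  meetLetters x y k with x ! k ⊓ y ! k ℕ.≟ suc m
  ... | yes _ = suc m
  ... | no  _ = prefixMin (λ j → x ! j ⊓ y ! j) k

  _∧_ : Word → Word → Word
  x ∧ y = word (meetLetters x y)

  module _ (x y : Word) where
    private
      z : Pos → ℕ
      z j = x ! j ⊓ y ! j

    meetLetters-≤ : ∀ k → meetLetters x y k ℕ.≤ z k
    meetLetters-≤ k with z k ℕ.≟ suc m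
    ... | yes zₖ≡1+m = ≤-reflexive (sym zₖ≡1+m)
    ... | no  _      = prefixMin-≤ z ≤-refl

    meetLetters-bounded : Bounded (meetLetters x y)
    meetLetters-bounded k = ≤-trans (meetLetters-≤ k) (≤-trans (m⊓n≤m _ _) (letter≤ x k))

    prefixMin≤meetLetters : ∀ k → prefixMin z k ℕ.≤ meetLetters x y k
    prefixMin≤meetLetters k with z k ℕ.≟ suc m
    ... | yes zₖ≡1+m = ≤-trans (prefixMin-≤ z ≤-refl) (≤-reflexive zₖ≡1+m)
    ... | no  _      = ≤-refl

    meetLetters-≡-prefixMin : ∀ k → meetLetters x y k ℕ.≤ m → meetLetters x y k ≡ prefixMin z k
    meetLetters-≡-prefixMin k with z k ℕ.≟ suc m
    ... | yes _ = λ 1+m≤m → ⊥-elim (1+n≰n 1+m≤m)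
    ... | no  _ = λ _ → refl

    ∧-isWord : IsWord m (suc n) x → IsWord m (suc n) (x ∧ y)
    ∧-isWord x-word = word-isWord meetLetters-bounded
      (≤-trans (meetLetters-≤ Fin.zero) (≤-trans (m⊓n≤m _ _) (head≤m x-word))) mn2-meet
      where
      mn2-meet : MN2 (meetLetters x y)
      mn2-meet {i} {j} j<i _ ≤m = begin
        meetLetters x y i ≡⟨ meetLetters-≡-prefixMin i ≤m ⟩
        prefixMin z i     ≤⟨ prefixMin-antitone z (<⇒≤ j<i) ⟩
        prefixMin z j     ≤⟨ prefixMin≤meetLetters j ⟩
        meetLetters x y j ∎
        where open ≤-Reasoning

    ≤-meetLetters : ∀ {w} → IsWord m (suc n) w → w ≤W x → w ≤W y → ∀ k → w ! k ℕ.≤ meetLetters x y k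
    ≤-meetLetters {w} w-word w≤x w≤y k with z k ℕ.≟ suc m
    ... | yes _      = letter≤ w k
    ... | no zₖ≢1+m  = prefixMin-greatest z k below
      where
      w≤z : ∀ j → w ! j ℕ.≤ z j
      w≤z j = ⊓-glb (w≤x j) (w≤y j)
      wₖ≤m : w ! k ℕ.≤ m
      wₖ≤m = ≤-pred (≤-<-trans (w≤z k) (≤∧≢⇒< (≤-trans (m⊓n≤m _ _) (letter≤ x k)) zₖ≢1+m))
      below : ∀ j → j Fin.≤ k → w ! k ℕ.≤ z j
      below j j≤k with m≤n⇒m<n∨m≡n j≤k | w ! k ℕ.≟ 0
      ... | inj₂ j≡k | _        = subst (λ j → w ! k ℕ.≤ z j) (sym (Finₚ.toℕ-injective j≡k)) (w≤z k)
      ... | inj₁ _   | yes wₖ≡0 = subst (ℕ._≤ z j) (sym wₖ≡0) z≤n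
      ... | inj₁ j<k | no wₖ≢0  = ≤-trans (mn2 w-word j<k (n≢0⇒n>0 wₖ≢0) wₖ≤m) (w≤z j)

    ∧-isMeet : IsWord m (suc n) x → IsMeet x y (x ∧ y)
    ∧-isMeet x-word =
      ∧-isWord x-word ,
      word-≤ x (λ k → ≤-trans (meetLetters-≤ k) (m⊓n≤m _ _)) ,
      word-≤ y (λ k → ≤-trans (meetLetters-≤ k) (m⊓n≤n _ _)) ,
      λ w w-word w≤x w≤y → ≤-word w (≤-meetLetters w-word w≤x w≤y)

  isLattice : IsLattice
  isLattice x y x-word y-word = (x ∨ y , ∨-isJoin x-word y-word) , (x ∧ y , ∧-isMeet x y x-word)

  -- Length

  rank : Word → ℕ
  rank w = sum (w !_)

  rank-< : ∀ {u v} → u < v → rank u ℕ.< rank v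
  rank-< {u} {v} (u≤v , u≢v)
    with Finₚ.¬∀⟶∃¬ (suc n) (λ k → u ! k ≡ v ! k) (λ k → u ! k ℕ.≟ v ! k) (u≢v ∘ letters-≡)
  ... | k , uₖ≢vₖ = sum-mono-< u≤v k (≤∧≢⇒< (u≤v k) uₖ≢vₖ)

  rank≤L : ∀ {w} → IsWord m (suc n) w → rank w ℕ.≤ L
  rank≤L {w} w-word = subst (rank w ℕ.≤_) sum-topLetter (sum-mono-≤ (≤topLetter w-word))

  chainLetters : ℕ → Pos → ℕ
  chainLetters = pour topLetter

  chainLetters-bounded : ∀ r → Bounded (chainLetters r)
  chainLetters-bounded r k = ≤-trans (pour-≤-cap topLetter r k) (topLetter-bounded k)

  chainWord : ℕ → Word
  chainWord r = word (chainLetters r)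

  chainWord-! : ∀ r k → chainWord r ! k ≡ chainLetters r k
  chainWord-! r = bounded-word-! (chainLetters-bounded r)

  chainWord-isWord : ∀ r → IsWord m (suc n) (chainWord r)
  chainWord-isWord r = word-isWord (chainLetters-bounded r) (pour-≤-cap topLetter r Fin.zero) mn2-chain
    where
    mn2-chain : MN2 (chainLetters r)
    mn2-chain {i} {j} j<i 1≤cᵢ cᵢ≤m = begin
      chainLetters r i ≤⟨ cᵢ≤m ⟩
      m                ≤⟨ m≤topLetter j ⟩
      topLetter j      ≡⟨ pour-full-before topLetter r j<i (n>0⇒n≢0 1≤cᵢ) ⟨
      chainLetters r j ∎
      where open ≤-Reasoning

  rank-chainWord : ∀ {r} → r ℕ.≤ L → rank (chainWord r) ≡ r
  rank-chainWord {r} r≤L =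
    trans (sum-cong-≗ (chainWord-! r)) (sum-pour topLetter (subst (r ℕ.≤_) (sym sum-topLetter) r≤L))

  chainWord-< : ∀ {r} → r ℕ.< L → chainWord r < chainWord (suc r)
  chainWord-< {r} r<L = chainWord-≤ , chainWord-≢
    where
    chainWord-≤ : chainWord r ≤W chainWord (suc r)
    chainWord-≤ k = subst₂ ℕ._≤_ (sym (chainWord-! r k)) (sym (chainWord-! (suc r) k))
                      (pour-monoʳ-≤ topLetter (n≤1+n r) k)
    chainWord-≢ : chainWord r ≢ chainWord (suc r)
    chainWord-≢ eq = 1+n≢n (begin
      suc r                    ≡⟨ rank-chainWord r<L ⟨
      rank (chainWord (suc r)) ≡⟨ cong rank eq ⟨
      rank (chainWord r)       ≡⟨ rank-chainWord (<⇒≤ r<L) ⟩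
      r                        ∎)
      where open ≡-Reasoning

  chain : List Word
  chain = applyUpTo chainWord (suc L)

  length-chain : length chain ≡ suc L
  length-chain = length-applyUpTo chainWord (suc L)

  chain-isChain : IsChain chain
  chain-isChain = Allₚ.applyUpTo⁺₂ chainWord (suc L) chainWord-isWord ,
                  Linkedₚ.applyUpTo⁺₁ chainWord (suc L) (chainWord-< ∘ ≤-pred)

  hasLength : HasLength L
  hasLength = (chain , chain-isChain , length-chain) ,
              λ c (c-words , c-linked) → length-Linked-≤ rank rank-< c (All.map rank≤L c-words) c-linked

  -- Left modularity

  Staircase : Word → Set
  Staircase x = ∀ {i j} → j Fin.< i → x ! i ≢ 0 → x ! j ≡ topLetter j

  chainWord-staircase : ∀ r → Staircase (chainWord r)
  chainWord-staircase r {i} {j} j<i xᵢ≢0 =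
    trans (chainWord-! r j) (pour-full-before topLetter r j<i (xᵢ≢0 ∘ trans (chainWord-! r i)))

  truncationLetters : Word → Pos → Pos → ℕ
  truncationLetters b i k with k Fin.≤? i
  ... | yes _ = b ! k
  ... | no  _ = 0

  module _ (b : Word) (i : Pos) where

    truncationLetters-≤ : ∀ k → truncationLetters b i k ℕ.≤ b ! k
    truncationLetters-≤ k with k Fin.≤? i
    ... | yes _ = ≤-refl
    ... | no  _ = z≤n

    truncationLetters-upTo : ∀ {k} → k Fin.≤ i → truncationLetters b i k ≡ b ! k
    truncationLetters-upTo {k} k≤i with k Fin.≤? i
    ... | yes _   = refl
    ... | no  k≰i = ⊥-elim (k≰i k≤i)

    truncate : Word
    truncate = word (truncationLetters b i)

    truncationLetters-bounded : Bounded (truncationLetters b i)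
    truncationLetters-bounded k = ≤-trans (truncationLetters-≤ k) (letter≤ b k)

    truncate-≤ : truncate ≤W b
    truncate-≤ = word-≤ b truncationLetters-≤

    truncate-at : truncate ! i ≡ b ! i
    truncate-at = trans (bounded-word-! truncationLetters-bounded i) (truncationLetters-upTo ≤-refl)

    truncate-isWord : IsWord m (suc n) b → IsWord m (suc n) truncate
    truncate-isWord b-word = word-isWord truncationLetters-bounded
      (≤-trans (truncationLetters-≤ Fin.zero) (head≤m b-word)) mn2-truncation
      where
      mn2-truncation : MN2 (truncationLetters b i)
      mn2-truncation {k} {j} j<k with k Fin.≤? i
      ... | no  _   = λ ()
      ... | yes k≤i rewrite truncationLetters-upTo (≤-trans (<⇒≤ j<k) k≤i) = mn2 b-word j<k

    truncate-≤-staircase : ∀ {x} → IsWord m (suc n) b → Staircase x → x ! i ≢ 0 → b ! i ℕ.≤ x ! i →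
                           truncate ≤W x
    truncate-≤-staircase {x} b-word stair xᵢ≢0 bᵢ≤xᵢ = word-≤ x below
      where
      below : ∀ k → truncationLetters b i k ℕ.≤ x ! k
      below k with k Fin.≤? i
      ... | no  _   = z≤n
      ... | yes k≤i with m≤n⇒m<n∨m≡n k≤i
      ...   | inj₁ k<i = subst (b ! k ℕ.≤_) (sym (stair k<i xᵢ≢0)) (≤topLetter b-word k)
      ...   | inj₂ k≡i rewrite Finₚ.toℕ-injective k≡i = bᵢ≤xᵢ

  -- In (p ∨ x) ∧ q, a letter exceeding that of p is a letter of x; cutting the word off after it
  -- gives a word below x (as x is full before its nonzero letters) and below q, hence below x ∧ q.
  staircase-leftModular : ∀ {x} → IsWord m (suc n) x → Staircase x → LeftModular x
  staircase-leftModular {x} x-word stair = x-word , modular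
    where
    modular : ∀ p q → IsWord m (suc n) p → IsWord m (suc n) q → p < q →
              ∀ a b c d → IsJoin p x a → IsMeet a q b → IsMeet x q c → IsJoin p c d → b ≡ d
    modular p q p-word q-word (p≤q , _) a b c d a-join@(a-word , p≤a , x≤a , _)
            (b-word , b≤a , b≤q , b-greatest) (_ , c≤x , c≤q , c-greatest) (d-word , p≤d , c≤d , d-least) =
      ≤W-antisym b≤d d≤b
      where
      d≤b : d ≤W b
      d≤b = b-greatest d d-word (d-least a a-word p≤a (≤W-trans {c} {x} {a} c≤x x≤a))
                                (d-least q q-word p≤q c≤q)
      b≤d : b ≤W d
      b≤d i with b ! i ℕ.≤? p ! i
      ... | yes bᵢ≤pᵢ = ≤-trans bᵢ≤pᵢ (p≤d i)
      ... | no  bᵢ≰pᵢ = begin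
          b ! i            ≡⟨ truncate-at b i ⟨
          truncate b i ! i ≤⟨ truncate≤c i ⟩
          c ! i            ≤⟨ c≤d i ⟩
          d ! i            ∎
        where
        open ≤-Reasoning
        bᵢ≤xᵢ : b ! i ℕ.≤ x ! i
        bᵢ≤xᵢ = m≤n⊔o∧m≰n⇒m≤o (subst (b ! i ℕ.≤_) (join-! p-word x-word a-join i) (b≤a i)) bᵢ≰pᵢ
        xᵢ≢0 : x ! i ≢ 0
        xᵢ≢0 xᵢ≡0 = bᵢ≰pᵢ (≤-trans (subst (b ! i ℕ.≤_) xᵢ≡0 bᵢ≤xᵢ) z≤n)
        truncate≤c : truncate b i ≤W c
        truncate≤c = c-greatest (truncate b i) (truncate-isWord b i b-word)
                       (truncate-≤-staircase b i {x} b-word stair xᵢ≢0 bᵢ≤xᵢ)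
                       (≤W-trans {truncate b i} {b} {q} (truncate-≤ b i) b≤q)

  zero⇒IsBottom : ∀ {x} → (∀ k → x ! k ≡ 0) → IsBottom x
  zero⇒IsBottom x≡0 u _ k = subst (ℕ._≤ u ! k) (sym (x≡0 k)) z≤n

  bottom : Word
  bottom = word (λ _ → 0)

  bottom-isWord : IsWord m (suc n) bottom
  bottom-isWord = word-isWord (λ _ → z≤n) z≤n (λ _ ())

  nonzero⇒¬IsBottom : ∀ {x k} → x ! k ≢ 0 → ¬ IsBottom x
  nonzero⇒¬IsBottom {x} {k} xₖ≢0 x-bottom =
    xₖ≢0 (n≤0⇒n≡0 (subst (x ! k ℕ.≤_) (bounded-word-! (λ _ → z≤n) k) (x-bottom bottom bottom-isWord k)))

  top : Word
  top = word topLetter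

  top-! : ∀ k → top ! k ≡ topLetter k
  top-! = bounded-word-! topLetter-bounded

  topLetter≤m⇒zero : ∀ {i} → topLetter i ℕ.≤ m → i ≡ Fin.zero
  topLetter≤m⇒zero {Fin.zero}  _     = refl
  topLetter≤m⇒zero {Fin.suc _} 1+m≤m = ⊥-elim (1+n≰n 1+m≤m)

  m<topLetter : ∀ {i j : Pos} → j Fin.< i → m ℕ.< topLetter i
  m<topLetter {Fin.suc _} _ = ≤-refl

  top-isWord : IsWord m (suc n) top
  top-isWord = word-isWord topLetter-bounded ≤-refl λ j<i _ top≤m → ⊥-elim (<⇒≱ (m<topLetter j<i) top≤m)

  ≡topLetter⇒IsTop : ∀ {x} → (∀ k → x ! k ≡ topLetter k) → IsTop x
  ≡topLetter⇒IsTop x≡top u u-word k = subst (u ! k ℕ.≤_) (sym (x≡top k)) (≤topLetter u-word k)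

  infix 30 _[_]≔_
  _[_]≔_ : Word → Pos → ℕ → Word
  x [ i ]≔ v = word (updateAt (x !_) i (λ _ → v))

  module _ (x : Word) (i : Pos) {v : ℕ} where

    []≔-at : v ℕ.≤ suc m → (x [ i ]≔ v) ! i ≡ v
    []≔-at v≤1+m = trans (word-! _ i) (trans (cong (_⊓ suc m) (updateAt-updates i (x !_))) (m≤n⇒m⊓n≡m v≤1+m))

    []≔-other : ∀ {k} → k ≢ i → (x [ i ]≔ v) ! k ≡ x ! k
    []≔-other {k} k≢i =
      trans (word-! _ k) (trans (cong (_⊓ suc m) (updateAt-minimal k i (x !_) k≢i)) (m≤n⇒m⊓n≡m (letter≤ x k)))

    []≔-≤ : (u : Word) → v ℕ.≤ u ! i → (∀ k → k ≢ i → x ! k ℕ.≤ u ! k) → x [ i ]≔ v ≤W u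
    []≔-≤ u v≤uᵢ x≤u k with k Finₚ.≟ i
    ... | yes refl = subst (ℕ._≤ u ! k) (sym ([]≔-at (≤-trans v≤uᵢ (letter≤ u k)))) v≤uᵢ
    ... | no  k≢i  = subst (ℕ._≤ u ! k) (sym ([]≔-other k≢i)) (x≤u k k≢i)

    ≤-[]≔ : (u : Word) → u ! i ℕ.≤ v → v ℕ.≤ suc m → (∀ k → k ≢ i → u ! k ℕ.≤ x ! k) → u ≤W x [ i ]≔ v
    ≤-[]≔ u uᵢ≤v v≤1+m u≤x k with k Finₚ.≟ i
    ... | yes refl = subst (u ! k ℕ.≤_) (sym ([]≔-at v≤1+m)) uᵢ≤v
    ... | no  k≢i  = subst (u ! k ℕ.≤_) (sym ([]≔-other k≢i)) (u≤x k k≢i)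

    []≔-isWord : IsWord m (suc n) x → v ℕ.≤ topLetter i →
                 (∀ {j} → j Fin.< i → 1 ℕ.≤ v → v ℕ.≤ m → v ℕ.≤ x ! j) →
                 (∀ {k} → i Fin.< k → 1 ℕ.≤ x ! k → x ! k ℕ.≤ m → x ! k ℕ.≤ v) →
                 IsWord m (suc n) (x [ i ]≔ v)
    []≔-isWord x-word v≤top earlier later = isWord head mn2-[]≔
      where
      v≤1+m : v ℕ.≤ suc m
      v≤1+m = ≤-trans v≤top (topLetter-bounded i)
      head : (x [ i ]≔ v) ! Fin.zero ℕ.≤ m
      head with Fin.zero Finₚ.≟ i
      ... | yes refl = subst (ℕ._≤ m) (sym ([]≔-at v≤1+m)) v≤top
      ... | no  0≢i  = subst (ℕ._≤ m) (sym ([]≔-other 0≢i)) (head≤m x-word)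
      mn2-[]≔ : MN2 ((x [ i ]≔ v) !_)
      mn2-[]≔ {k} {j} j<k with k Finₚ.≟ i
      ... | yes refl rewrite []≔-at v≤1+m | []≔-other (Finₚ.<⇒≢ j<k) = earlier j<k
      ... | no  k≢i  with j Finₚ.≟ i
      ...   | yes refl rewrite []≔-other k≢i | []≔-at v≤1+m = later j<k
      ...   | no  j≢i  rewrite []≔-other k≢i | []≔-other j≢i = mn2 x-word j<k

  -- Join-irreducibles

  nonOrigin⇒<topLetter : ∀ {i : Pos} {s : Fin (suc m)} → NonOrigin i s → m ∸ toℕ s ℕ.< topLetter i
  nonOrigin⇒<topLetter {Fin.zero}  {Fin.zero}  nonOrigin = ⊥-elim (nonOrigin (refl , refl))
  nonOrigin⇒<topLetter {Fin.zero}  {Fin.suc s} _         = complement-suc-< s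
  nonOrigin⇒<topLetter {Fin.suc _} {s}         _         = s≤s (m∸n≤m m (toℕ s))

  <topLetter⇒nonOrigin : ∀ {i : Pos} {s : Fin (suc m)} → m ∸ toℕ s ℕ.< topLetter i → NonOrigin i s
  <topLetter⇒nonOrigin m<m (refl , refl) = 1+n≰n m<m

  jiLetter : Fin (suc m) → ℕ
  jiLetter s = suc (m ∸ toℕ s)

  -- the bound that the letter jiLetter s imposes on all earlier letters (none for the letter m + 1)
  forcedBefore : Fin (suc m) → ℕ
  forcedBefore Fin.zero    = 0
  forcedBefore (Fin.suc s) = jiLetter (Fin.suc s)

  forcedBefore-≤m : ∀ s → forcedBefore s ℕ.≤ m
  forcedBefore-≤m Fin.zero    = z≤n
  forcedBefore-≤m (Fin.suc s) = complement-suc-< s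

  forcedBefore-≤ : ∀ s {p : Word} {i k} → IsWord m (suc n) p → k Fin.< i → p ! i ≡ jiLetter s →
                   forcedBefore s ℕ.≤ p ! k
  forcedBefore-≤ Fin.zero    _      _   _   = z≤n
  forcedBefore-≤ (Fin.suc s) p-word k<i pᵢ≡ = subst (ℕ._≤ _) pᵢ≡
    (mn2 p-word k<i (subst (1 ℕ.≤_) (sym pᵢ≡) (s≤s z≤n)) (subst (ℕ._≤ m) (sym pᵢ≡) (complement-suc-< s)))

  jiLetters : Pos → Fin (suc m) → Pos → ℕ
  jiLetters i s k with Finₚ.<-cmp k i
  ... | tri< _ _ _ = forcedBefore s
  ... | tri≈ _ _ _ = jiLetter s
  ... | tri> _ _ _ = 0

  -- the least word with letter jiLetter s at position i; the index s is reversed so that the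
  -- excluded pair, the letter m + 1 in front, is (0, 0)
  joinIrreducible : Pos → Fin (suc m) → Word
  joinIrreducible i s = word (jiLetters i s)

  module _ (i : Pos) (s : Fin (suc m)) where

    jiLetters-bounded : Bounded (jiLetters i s)
    jiLetters-bounded k with Finₚ.<-cmp k i
    ... | tri< _ _ _ = ≤-trans (forcedBefore-≤m s) (n≤1+n m)
    ... | tri≈ _ _ _ = s≤s (m∸n≤m m (toℕ s))
    ... | tri> _ _ _ = z≤n

    jiLetters-before : ∀ {k} → k Fin.< i → jiLetters i s k ≡ forcedBefore s
    jiLetters-before {k} k<i with Finₚ.<-cmp k i
    ... | tri< _    _ _ = refl
    ... | tri≈ k≮i _ _ = ⊥-elim (k≮i k<i)
    ... | tri> k≮i _ _ = ⊥-elim (k≮i k<i)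

    joinIrreducible-! : ∀ k → joinIrreducible i s ! k ≡ jiLetters i s k
    joinIrreducible-! = bounded-word-! jiLetters-bounded

    joinIrreducible-at : joinIrreducible i s ! i ≡ jiLetter s
    joinIrreducible-at with Finₚ.<-cmp i i | joinIrreducible-! i
    ... | tri< _ i≢i _ | _  = ⊥-elim (i≢i refl)
    ... | tri≈ _ _ _   | eq = eq
    ... | tri> _ i≢i _ | _  = ⊥-elim (i≢i refl)

    joinIrreducible-after : ∀ {k} → i Fin.< k → joinIrreducible i s ! k ≡ 0
    joinIrreducible-after {k} i<k with Finₚ.<-cmp k i | joinIrreducible-! k
    ... | tri< _ _ i≮k | _  = ⊥-elim (i≮k i<k)
    ... | tri≈ _ _ i≮k | _  = ⊥-elim (i≮k i<k)
    ... | tri> _ _ _   | eq = eq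

    joinIrreducible-≤ : ∀ {p} → IsWord m (suc n) p → p ! i ≡ jiLetter s → joinIrreducible i s ≤W p
    joinIrreducible-≤ {p} p-word pᵢ≡ = word-≤ p below
      where
      below : ∀ k → jiLetters i s k ℕ.≤ p ! k
      below k with Finₚ.<-cmp k i
      ... | tri< k<i _ _ = forcedBefore-≤ s p-word k<i pᵢ≡
      ... | tri≈ _ refl _ = ≤-reflexive (sym pᵢ≡)
      ... | tri> _ _ _    = z≤n

    joinIrreducible-isWord : NonOrigin i s → IsWord m (suc n) (joinIrreducible i s)
    joinIrreducible-isWord nonOrigin = word-isWord jiLetters-bounded head mn2-ji
      where
      head : jiLetters i s Fin.zero ℕ.≤ m
      head with Finₚ.<-cmp Fin.zero i
      ... | tri< _ _ _    = forcedBefore-≤m s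
      ... | tri≈ _ refl _ = nonOrigin⇒<topLetter nonOrigin
      ... | tri> _ _ _    = z≤n
      mn2-ji : MN2 (jiLetters i s)
      mn2-ji {k} {j} j<k with Finₚ.<-cmp k i
      ... | tri< k<i _ _  rewrite jiLetters-before (Finₚ.<-trans j<k k<i) = λ _ _ → ≤-refl
      ... | tri≈ _ refl _ rewrite jiLetters-before j<k = letter≤forced s
        where
        letter≤forced : ∀ s → 1 ℕ.≤ jiLetter s → jiLetter s ℕ.≤ m → jiLetter s ℕ.≤ forcedBefore s
        letter≤forced Fin.zero    _ 1+m≤m = ⊥-elim (1+n≰n 1+m≤m)
        letter≤forced (Fin.suc s) _ _     = ≤-refl
      ... | tri> _ _ _ = λ ()

    joinIrreducible-joinIrr : NonOrigin i s → JoinIrr (joinIrreducible i s)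
    joinIrreducible-joinIrr nonOrigin = x-word , nonzero⇒¬IsBottom {x} {i} xᵢ≢0 , irreducible
      where
      x = joinIrreducible i s
      x-word = joinIrreducible-isWord nonOrigin
      xᵢ≢0 : x ! i ≢ 0
      xᵢ≢0 xᵢ≡0 = 0≢1+n (trans (sym xᵢ≡0) joinIrreducible-at)
      is-x : ∀ {u} → IsWord m (suc n) u → u ≤W x → u ! i ≡ x ! i → u ≡ x
      is-x u-word u≤x uᵢ≡xᵢ = ≤W-antisym u≤x (joinIrreducible-≤ u-word (trans uᵢ≡xᵢ joinIrreducible-at))
      irreducible : ∀ p q → IsWord m (suc n) p → IsWord m (suc n) q → IsJoin p q x → p ≡ x ⊎ q ≡ x
      irreducible p q p-word q-word x-join@(_ , p≤x , q≤x , _) with ⊔-sel (p ! i) (q ! i)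
      ... | inj₁ eq = inj₁ (is-x p-word p≤x (trans (sym eq) (sym (join-! p-word q-word x-join i))))
      ... | inj₂ eq = inj₂ (is-x q-word q≤x (trans (sym eq) (sym (join-! p-word q-word x-join i))))

  joinIrreducible-≢ : ∀ {i i′ s s′} → i Fin.< i′ → joinIrreducible i s ≢ joinIrreducible i′ s′
  joinIrreducible-≢ {i} {i′} {s} {s′} i<i′ eq = 0≢1+n (begin
    0                          ≡⟨ joinIrreducible-after i s i<i′ ⟨
    joinIrreducible i s ! i′   ≡⟨ cong (_! i′) eq ⟩
    joinIrreducible i′ s′ ! i′ ≡⟨ joinIrreducible-at i′ s′ ⟩
    jiLetter s′                ∎)
    where open ≡-Reasoning

  joinIrreducible-injective : ∀ {i i′ s s′} → joinIrreducible i s ≡ joinIrreducible i′ s′ → i ≡ i′ × s ≡ s′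
  joinIrreducible-injective {i} {i′} {s} {s′} eq with Finₚ.<-cmp i i′
  ... | tri< i<i′ _ _ = ⊥-elim (joinIrreducible-≢ i<i′ eq)
  ... | tri> _ _ i′<i = ⊥-elim (joinIrreducible-≢ i′<i (sym eq))
  ... | tri≈ _ refl _ = refl , complement-injective (suc-injective (begin
    jiLetter s              ≡⟨ joinIrreducible-at i s ⟨
    joinIrreducible i s ! i  ≡⟨ cong (_! i) eq ⟩
    joinIrreducible i s′ ! i ≡⟨ joinIrreducible-at i s′ ⟩
    jiLetter s′             ∎))
    where open ≡-Reasoning

  lastLetter-isJoin : ∀ {x i s} → IsWord m (suc n) x → NonOrigin i s → x ! i ≡ jiLetter s →
                      (∀ {k} → i Fin.< k → x ! k ≡ 0) → IsJoin (joinIrreducible i s) (x [ i ]≔ 0) x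
  lastLetter-isJoin {x} {i} {s} x-word nonOrigin xᵢ≡ zero-after =
    x-word , joinIrreducible-≤ i s x-word xᵢ≡ , []≔-≤ x i x (z≤n) (λ _ _ → ≤-refl) , least
    where
    least : ∀ u → IsWord m (suc n) u → joinIrreducible i s ≤W u → x [ i ]≔ 0 ≤W u → x ≤W u
    least u _ ji≤u erased≤u k with k Finₚ.≟ i
    ... | yes refl = subst (ℕ._≤ u ! k) (trans (joinIrreducible-at k s) (sym xᵢ≡)) (ji≤u k)
    ... | no  k≢i  = subst (ℕ._≤ u ! k) ([]≔-other x i k≢i) (erased≤u k)

  joinIrr-lastLetter : ∀ {x i s} → JoinIrr x → NonOrigin i s → x ! i ≡ jiLetter s →
                       (∀ {k} → i Fin.< k → x ! k ≡ 0) → x ≡ joinIrreducible i s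
  joinIrr-lastLetter {x} {i} {s} (x-word , _ , irreducible) nonOrigin xᵢ≡ zero-after
    with irreducible (joinIrreducible i s) (x [ i ]≔ 0) (joinIrreducible-isWord i s nonOrigin) erased-word
           (lastLetter-isJoin x-word nonOrigin xᵢ≡ zero-after)
    where
    erased-word : IsWord m (suc n) (x [ i ]≔ 0)
    erased-word = []≔-isWord x i x-word z≤n (λ _ ())
                    (λ i<k 1≤xₖ _ → ⊥-elim (1+n≰n (subst (1 ℕ.≤_) (zero-after i<k) 1≤xₖ)))
  ... | inj₁ ji≡x     = sym ji≡x
  ... | inj₂ erased≡x = ⊥-elim (0≢1+n (begin
    0                   ≡⟨ []≔-at x i z≤n ⟨
    (x [ i ]≔ 0) ! i    ≡⟨ cong (_! i) erased≡x ⟩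
    x ! i               ≡⟨ xᵢ≡ ⟩
    jiLetter s          ∎))
    where open ≡-Reasoning

  joinIrr⇒joinIrreducible : ∀ {x} → JoinIrr x → ∃₂ λ i s → NonOrigin i s × x ≡ joinIrreducible i s
  joinIrr⇒joinIrreducible {x} x-joinIrr@(x-word , x≢⊥ , _)
    with Finₚ.¬∀⟶∃¬ (suc n) (λ k → x ! k ≡ 0) (λ k → x ! k ℕ.≟ 0) (x≢⊥ ∘ zero⇒IsBottom {x})
  ... | k , xₖ≢0 with ∃⟶∃-greatest (λ k → ¬? (x ! k ℕ.≟ 0)) k xₖ≢0
  ...   | i , xᵢ≢0 , nonzero-after with suc-complement-surjective (n≢0⇒n>0 xᵢ≢0) (letter≤ x i)
  ...     | s , jiLetter≡xᵢ =
    i , s , nonOrigin , joinIrr-lastLetter x-joinIrr nonOrigin (sym jiLetter≡xᵢ) zero-after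
    where
    nonOrigin : NonOrigin i s
    nonOrigin = <topLetter⇒nonOrigin (subst (ℕ._≤ topLetter i) (sym jiLetter≡xᵢ) (≤topLetter x-word i))
    zero-after : ∀ {k} → i Fin.< k → x ! k ≡ 0
    zero-after i<k = decidable-stable (x ! _ ℕ.≟ 0) (nonzero-after i<k)

  -- Meet-irreducibles

  top[]≔-isWord : ∀ {i v} → v ℕ.≤ topLetter i → IsWord m (suc n) (top [ i ]≔ v)
  top[]≔-isWord {i} {v} v≤top = []≔-isWord top i top-isWord v≤top earlier later
    where
    earlier : ∀ {j} → j Fin.< i → 1 ℕ.≤ v → v ℕ.≤ m → v ℕ.≤ top ! j
    earlier {j} _ _ v≤m = subst (v ℕ.≤_) (sym (top-! j)) (≤-trans v≤m (m≤topLetter j))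
    later : ∀ {k} → i Fin.< k → 1 ℕ.≤ top ! k → top ! k ℕ.≤ m → top ! k ℕ.≤ v
    later {k} i<k _ topₖ≤m = ⊥-elim (<⇒≱ (m<topLetter i<k) (subst (ℕ._≤ m) (top-! k) topₖ≤m))

  ≤-top[]≔ : ∀ {p i v} → IsWord m (suc n) p → p ! i ℕ.≤ v → v ℕ.≤ suc m → p ≤W top [ i ]≔ v
  ≤-top[]≔ {p} {i} p-word pᵢ≤v v≤1+m =
    ≤-[]≔ top i p pᵢ≤v v≤1+m (λ k _ → subst (p ! k ℕ.≤_) (sym (top-! k)) (≤topLetter p-word k))

  top[]≔-meetIrr : ∀ {i v} → v ℕ.< topLetter i → MeetIrr (top [ i ]≔ v)
  top[]≔-meetIrr {i} {v} v<top = top[]≔-isWord (<⇒≤ v<top) , x≢⊤ , irreducible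
    where
    x = top [ i ]≔ v
    v≤1+m : v ℕ.≤ suc m
    v≤1+m = ≤-trans (<⇒≤ v<top) (topLetter-bounded i)
    x≢⊤ : ¬ IsTop x
    x≢⊤ x-top = <⇒≱ v<top (begin
      topLetter i ≡⟨ top-! i ⟨
      top ! i     ≤⟨ x-top top top-isWord i ⟩
      x ! i       ≡⟨ []≔-at top i v≤1+m ⟩
      v           ∎)
      where open ≤-Reasoning
    is-x : ∀ {p} → IsWord m (suc n) p → x ≤W p → p ! i ℕ.≤ v → p ≡ x
    is-x p-word x≤p pᵢ≤v = ≤W-antisym (≤-top[]≔ p-word pᵢ≤v v≤1+m) x≤p
    above : ∀ r → x ≤W r → ¬ r ! i ℕ.≤ v → top [ i ]≔ suc v ≤W r
    above r x≤r rᵢ≰v = []≔-≤ top i r (≰⇒> rᵢ≰v) (λ k k≢i → subst (ℕ._≤ r ! k) ([]≔-other top i k≢i) (x≤r k))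
    irreducible : ∀ p q → IsWord m (suc n) p → IsWord m (suc n) q → IsMeet p q x → p ≡ x ⊎ q ≡ x
    irreducible p q p-word q-word (_ , x≤p , x≤q , x-greatest) with p ! i ℕ.≤? v | q ! i ℕ.≤? v
    ... | yes pᵢ≤v | _        = inj₁ (is-x p-word x≤p pᵢ≤v)
    ... | no  _    | yes qᵢ≤v = inj₂ (is-x q-word x≤q qᵢ≤v)
    ... | no  pᵢ≰v | no  qᵢ≰v = ⊥-elim (1+n≰n (begin
      suc v                  ≡⟨ []≔-at top i v<top′ ⟨
      (top [ i ]≔ suc v) ! i ≤⟨ x-greatest _ (top[]≔-isWord v<top) (above p x≤p pᵢ≰v) (above q x≤q qᵢ≰v) i ⟩
      x ! i                  ≡⟨ []≔-at top i v≤1+m ⟩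
      v                      ∎))
      where
      open ≤-Reasoning
      v<top′ : suc v ℕ.≤ suc m
      v<top′ = ≤-trans v<top (topLetter-bounded i)

  meetIrr⇒≡top[]≔ : ∀ {x i} → MeetIrr x → x ! i ℕ.< topLetter i → top [ i ]≔ (x ! i) ≡ x
  meetIrr⇒≡top[]≔ {x} {i} (x-word , _ , irreducible) xᵢ<top
    with irreducible (top [ i ]≔ (x ! i)) (x [ i ]≔ topLetter i) (top[]≔-isWord (<⇒≤ xᵢ<top)) raised-word
           (x-word , ≤-top[]≔ x-word ≤-refl (letter≤ x i) , x≤raised , greatest)
    where
    raised-word : IsWord m (suc n) (x [ i ]≔ topLetter i)
    raised-word = []≔-isWord x i x-word ≤-refl
      (λ j<i _ top≤m → ⊥-elim (<⇒≱ (m<topLetter j<i) top≤m))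
      (λ {k} _ _ xₖ≤m → ≤-trans xₖ≤m (m≤topLetter i))
    x≤raised : x ≤W x [ i ]≔ topLetter i
    x≤raised = ≤-[]≔ x i x (≤topLetter x-word i) (topLetter-bounded i) (λ _ _ → ≤-refl)
    greatest : ∀ u → IsWord m (suc n) u → u ≤W top [ i ]≔ (x ! i) → u ≤W x [ i ]≔ topLetter i → u ≤W x
    greatest u _ u≤lowered u≤raised k with k Finₚ.≟ i
    ... | yes refl = subst (u ! k ℕ.≤_) ([]≔-at top k (letter≤ x k)) (u≤lowered k)
    ... | no  k≢i  = subst (u ! k ℕ.≤_) ([]≔-other x i k≢i) (u≤raised k)
  ... | inj₁ lowered≡x = lowered≡x
  ... | inj₂ raised≡x  = ⊥-elim (<⇒≢ xᵢ<top (begin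
    x ! i                          ≡⟨ cong (_! i) raised≡x ⟨
    (x [ i ]≔ topLetter i) ! i     ≡⟨ []≔-at x i (topLetter-bounded i) ⟩
    topLetter i                    ∎))
    where open ≡-Reasoning

  meetIrreducible : Pos → Fin (suc m) → Word
  meetIrreducible i t = top [ i ]≔ (m ∸ toℕ t)

  complement≤1+m : (t : Fin (suc m)) → m ∸ toℕ t ℕ.≤ suc m
  complement≤1+m t = ≤-trans (m∸n≤m m (toℕ t)) (n≤1+n m)

  meetIrr⇒meetIrreducible : ∀ {x} → MeetIrr x → ∃₂ λ i t → NonOrigin i t × x ≡ meetIrreducible i t
  meetIrr⇒meetIrreducible {x} x-meetIrr@(x-word , x≢⊤ , _)
    with Finₚ.¬∀⟶∃¬ (suc n) (λ k → x ! k ≡ topLetter k) (λ k → x ! k ℕ.≟ topLetter k)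
                    (x≢⊤ ∘ ≡topLetter⇒IsTop {x})
  ... | i , xᵢ≢top = i , t , <topLetter⇒nonOrigin (subst (ℕ._< topLetter i) (sym m∸t≡xᵢ) xᵢ<top) , x≡
    where
    xᵢ<top : x ! i ℕ.< topLetter i
    xᵢ<top = ≤∧≢⇒< (≤topLetter x-word i) xᵢ≢top
    complement = complement-surjective (≤-pred (≤-trans xᵢ<top (topLetter-bounded i)))
    t = proj₁ complement
    m∸t≡xᵢ = proj₂ complement
    x≡ : x ≡ meetIrreducible i t
    x≡ = trans (sym (meetIrr⇒≡top[]≔ x-meetIrr xᵢ<top)) (cong (top [ i ]≔_) (sym m∸t≡xᵢ))

  -- for i ≢ i′ each of the positions i, i′ carries a top letter in one word and a letter m ∸ t in
  -- the other, which only position 0 allows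
  meetIrreducible-injective : ∀ {i i′ t t′} → meetIrreducible i t ≡ meetIrreducible i′ t′ → i ≡ i′ × t ≡ t′
  meetIrreducible-injective {i} {i′} {t} {t′} eq with i Finₚ.≟ i′
  ... | yes refl = refl , complement-injective (begin
    m ∸ toℕ t                ≡⟨ []≔-at top i (complement≤1+m t) ⟨
    meetIrreducible i t ! i  ≡⟨ cong (_! i) eq ⟩
    meetIrreducible i t′ ! i ≡⟨ []≔-at top i (complement≤1+m t′) ⟩
    m ∸ toℕ t′               ∎)
    where open ≡-Reasoning
  ... | no i≢i′ =
    ⊥-elim (i≢i′ (trans (position-zero t t′ eq i≢i′) (sym (position-zero t′ t (sym eq) (i≢i′ ∘ sym)))))
    where
    position-zero : ∀ {k k′} u u′ → meetIrreducible k u ≡ meetIrreducible k′ u′ → k ≢ k′ → k ≡ Fin.zero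
    position-zero {k} {k′} u u′ eq k≢k′ = topLetter≤m⇒zero (begin
      topLetter k               ≡⟨ top-! k ⟨
      top ! k                   ≡⟨ []≔-other top k′ k≢k′ ⟨
      meetIrreducible k′ u′ ! k ≡⟨ cong (_! k) eq ⟨
      meetIrreducible k u ! k   ≡⟨ []≔-at top k (complement≤1+m u) ⟩
      m ∸ toℕ u                 ≤⟨ m∸n≤m m (toℕ u) ⟩
      m                         ∎)
      where open ≤-Reasoning

  joinIrr-size : HasSize JoinIrr L
  joinIrr-size = size-without-origin joinIrreducible joinIrreducible-injective JoinIrr
                   joinIrreducible-joinIrr (λ _ → joinIrr⇒joinIrreducible)

  meetIrr-size : HasSize MeetIrr L
  meetIrr-size = size-without-origin meetIrreducible meetIrreducible-injective MeetIrr
                   (λ _ _ → top[]≔-meetIrr ∘ nonOrigin⇒<topLetter) (λ _ → meetIrr⇒meetIrreducible)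

  chain-leftModular : All LeftModular chain
  chain-leftModular = Allₚ.applyUpTo⁺₂ chainWord (suc L)
                        (λ r → staircase-leftModular (chainWord-isWord r) (chainWord-staircase r))

  trim : Trim
  trim = isLattice , L , (hasLength , joinIrr-size , meetIrr-size) ,
         chain , chain-isChain , length-chain , chain-leftModular

module EmptyWord (m : ℕ) where
  open W m 0

  empty-isWord : IsWord m 0 []
  empty-isWord = record { mn1 = λ () ; mn2 = λ _ _ _ () }

  trim : Trim
  trim = isLattice , 0 , (hasLength , nil-size ¬joinIrr , nil-size ¬meetIrr) ,
         ([] ∷ []) , singleton , refl , (leftModular ∷ [])
    where
    isLattice : IsLattice
    isLattice [] [] _ _ = ([] , empty-isWord , (λ ()) , (λ ()) , λ _ _ _ _ ()) ,
                          ([] , empty-isWord , (λ ()) , (λ ()) , λ _ _ _ _ ())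
    singleton : IsChain ([] ∷ [])
    singleton = empty-isWord ∷ [] , [-]
    hasLength : HasLength 0
    hasLength = (([] ∷ []) , singleton , refl) , bound
      where
      bound : ∀ c → IsChain c → length c ℕ.≤ 1
      bound []            _                   = z≤n
      bound (_ ∷ [])      _                   = s≤s z≤n
      bound ([] ∷ [] ∷ _) (_ , (_ , []≢[]) ∷ _) = ⊥-elim ([]≢[] refl)
    ¬joinIrr : ¬ JoinIrr []
    ¬joinIrr (_ , []≢⊥ , _) = []≢⊥ λ { [] _ () }
    ¬meetIrr : ¬ MeetIrr []
    ¬meetIrr (_ , []≢⊤ , _) = []≢⊤ λ { [] _ () }
    nil-size : ∀ {Q} → ¬ Q [] → HasSize Q 0
    nil-size ¬Q[] = [] , [] , refl , λ { [] → mk⇔ (λ ()) (⊥-elim ∘ ¬Q[]) }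
    leftModular : LeftModular []
    leftModular = empty-isWord , λ { _ _ _ _ _ [] [] [] [] _ _ _ _ → refl }

corollary4p8 : (m n : ℕ) → W.Trim m n
corollary4p8 m zero    = EmptyWord.trim m
corollary4p8 m (suc n) = WordLattice.trim m n
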